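{- Let $a>1$ and $n\ge 1$ be integers. If $a^{2n}+a^n+1$ is prime, then $n=3^{j}$ for some integer $j\ge 0$. -}

module Defs where

module Submission where

-- Write N a n = a²ⁿ + aⁿ + 1.  The proof rests on two facts.
--
-- (1) Working modulo N a 1 = a² + a + 1 we have a³ ≡ 1, because
--     a³ = 1 + (a - 1)(a² + a + 1).  Hence aᵏ ≡ a^(k mod 3), and if 3 ∤ n
--     the residues of (2n, n) modulo 3 are (2, 1) or (1, 2), so
--     N a n ≡ a² + a + 1 ≡ 0.  For n ≥ 2 the strict monotonicity of N in n
--     makes a² + a + 1 a proper non-trivial divisor, so N a n is not prime.
-- (2) N a (3q) = N (a³) q, so when 3 ∣ n the question descends to q = n/3
--     with the larger base a³.
--
-- The theorem follows by strong induction on n: either 3 ∣ n and we descend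
-- via (2), or n = 1 = 3⁰, or (1) contradicts primality.

open import Defs
open import Data.Nat using (ℕ; _+_; _*_; _^_; _<_; _≤_)
open import Data.Nat.Primality using (Prime)
open import Data.Product using (∃-syntax)
open import Relation.Binary.PropositionalEquality using (_≡_)

open import Data.Nat.Base using (zero; suc; z≤n; s≤s; z<s; _%_; _/_; NonZero; >-nonZero; n>1⇒nonTrivial)
open import Data.Nat.Properties
open import Data.Nat.DivMod using ([m+kn]%n≡m%n; %-distribˡ-+; %-distribˡ-*; m≡m%n+[m/n]*n; m%n<n; n%n≡0)
open import Data.Nat.Divisibility using (_∣_; _∣?_; divides; m%n≡0⇒n∣m)
open import Data.Nat.Primality using (composite; composite⇒¬prime)
open import Data.Nat.Induction using (<-rec)
open import Data.Nat.Tactic.RingSolver using (solve-∀)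
open import Data.Product using (_×_; _,_)
open import Data.Sum using (_⊎_; inj₁; inj₂)
open import Data.Empty using (⊥-elim)
open import Relation.Nullary using (¬_; yes; no)
open import Relation.Binary.PropositionalEquality using (refl; sym; trans; cong; cong₂; subst; module ≡-Reasoning)

module Congruence (d : ℕ) .{{_ : NonZero d}} where
  open ≡-Reasoning

  infix 4 _≋_
  _≋_ : ℕ → ℕ → Set
  x ≋ y = x % d ≡ y % d

  +-cong : ∀ {x x′ y y′} → x ≋ x′ → y ≋ y′ → x + y ≋ x′ + y′
  +-cong {x} {x′} {y} {y′} x≋x′ y≋y′ = begin
    (x + y) % d             ≡⟨ %-distribˡ-+ x y d ⟩
    (x % d + y % d) % d     ≡⟨ cong₂ (λ u v → (u + v) % d) x≋x′ y≋y′ ⟩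
    (x′ % d + y′ % d) % d   ≡⟨ sym (%-distribˡ-+ x′ y′ d) ⟩
    (x′ + y′) % d           ∎

  *-cong : ∀ {x x′ y y′} → x ≋ x′ → y ≋ y′ → x * y ≋ x′ * y′
  *-cong {x} {x′} {y} {y′} x≋x′ y≋y′ = begin
    (x * y) % d             ≡⟨ %-distribˡ-* x y d ⟩
    (x % d * (y % d)) % d   ≡⟨ cong₂ (λ u v → (u * v) % d) x≋x′ y≋y′ ⟩
    (x′ % d * (y′ % d)) % d ≡⟨ sym (%-distribˡ-* x′ y′ d) ⟩
    (x′ * y′) % d           ∎

  ^-≋1 : ∀ {x} → x ≋ 1 → ∀ q → x ^ q ≋ 1
  ^-≋1 x≋1 zero    = refl
  ^-≋1 x≋1 (suc q) = *-cong x≋1 (^-≋1 x≋1 q)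

  -- If aᵏ ≡ 1 then the powers of a are periodic with period k:
  -- writing n = (n mod k) + (n div k)·k gives aⁿ = a^(n mod k)·(aᵏ)^(n div k).
  ^-periodic : ∀ a k .{{_ : NonZero k}} → a ^ k ≋ 1 → ∀ n → a ^ n ≋ a ^ (n % k)
  ^-periodic a k aᵏ≋1 n = begin
    a ^ n % d                                 ≡⟨ cong (λ e → a ^ e % d) (m≡m%n+[m/n]*n n k) ⟩
    a ^ (r + q * k) % d                       ≡⟨ cong (_% d) (^-distribˡ-+-* a r (q * k)) ⟩
    (a ^ r * a ^ (q * k)) % d                 ≡⟨ cong (λ e → (a ^ r * a ^ e) % d) (*-comm q k) ⟩
    (a ^ r * a ^ (k * q)) % d                 ≡⟨ cong (λ e → (a ^ r * e) % d) (sym (^-*-assoc a k q)) ⟩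
    (a ^ r * (a ^ k) ^ q) % d                 ≡⟨ *-cong {a ^ r} refl (^-≋1 aᵏ≋1 q) ⟩
    (a ^ r * 1) % d                           ≡⟨ cong (_% d) (*-identityʳ (a ^ r)) ⟩
    a ^ r % d                                 ∎
    where
      r = n % k
      q = n / k

N : ℕ → ℕ → ℕ
N a n = a ^ (2 * n) + a ^ n + 1

-- N a n ends in "+ 1", so it can serve as a modulus.
N-nonZero : ∀ a n → NonZero (N a n)
N-nonZero a n = >-nonZero (subst (0 <_) (+-comm 1 (a ^ (2 * n) + a ^ n)) z<s)

N-mono : ∀ {a m n} → 1 < a → m < n → N a m < N a n
N-mono {a} 1<a m<n =
  +-monoˡ-< 1 (+-mono-< (^-monoʳ-< a 1<a (*-monoʳ-< 2 m<n)) (^-monoʳ-< a 1<a m<n))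

N-scale : ∀ a k m → N a (m * k) ≡ N (a ^ k) m
N-scale a k m = cong₂ (λ u v → u + v + 1)
  (trans (cong (a ^_) (exponent k m)) (sym (^-*-assoc a k (2 * m))))
  (trans (cong (a ^_) (*-comm m k)) (sym (^-*-assoc a k m)))
  where
    exponent : ∀ k m → 2 * (m * k) ≡ k * (2 * m)
    exponent = solve-∀

non-multiple-residues : ∀ n → ¬ 3 ∣ n →
  (n % 3 ≡ 1 × (2 * n) % 3 ≡ 2) ⊎ (n % 3 ≡ 2 × (2 * n) % 3 ≡ 1)
non-multiple-residues n 3∤n with n % 3 in r | m%n<n n 3
... | 0 | _ = ⊥-elim (3∤n (m%n≡0⇒n∣m n 3 r))
... | 1 | _ = inj₁ (refl , trans (%-distribˡ-* 2 n 3) (cong (λ x → (2 * x) % 3) r))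
... | 2 | _ = inj₂ (refl , trans (%-distribˡ-* 2 n 3) (cong (λ x → (2 * x) % 3) r))
... | suc (suc (suc _)) | s≤s (s≤s (s≤s ()))

-- a³ ≡ 1 modulo a² + a + 1, since a³ = 1 + (a - 1)(a² + a + 1).
cube-mod : ∀ a .{{_ : NonZero (N a 1)}} → a ^ 3 % N a 1 ≡ 1 % N a 1
cube-mod zero    = refl
cube-mod (suc z) = trans (cong (_% N (suc z) 1) (cube z)) ([m+kn]%n≡m%n 1 z (N (suc z) 1))
  where
    cube : ∀ z → (1 + z) * ((1 + z) * ((1 + z) * 1))
               ≡ 1 + z * ((1 + z) * ((1 + z) * 1) + (1 + z) * 1 + 1)
    cube = solve-∀

module _ (a : ℕ) where
  instance
    N1-nonZero : NonZero (N a 1)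
    N1-nonZero = N-nonZero a 1

  open Congruence (N a 1)

  cube≋1 : a ^ 3 ≋ 1
  cube≋1 = cube-mod a

  N1∣N : ∀ n → ¬ 3 ∣ n → N a 1 ∣ N a n
  N1∣N n 3∤n = m%n≡0⇒n∣m (N a n) (N a 1) (trans N≋N1 (n%n≡0 (N a 1)))
    where
      reduce : ∀ e {r} → e % 3 ≡ r → a ^ e ≋ a ^ r
      reduce e e%3≡r = trans (^-periodic a 3 cube≋1 e) (cong (λ x → a ^ x % N a 1) e%3≡r)

      N≋N1 : N a n ≋ N a 1
      N≋N1 with non-multiple-residues n 3∤n
      ... | inj₁ (n%3≡1 , 2n%3≡2) = +-cong (+-cong (reduce (2 * n) 2n%3≡2) (reduce n n%3≡1)) refl
      ... | inj₂ (n%3≡2 , 2n%3≡1) = trans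
        (+-cong (+-cong (reduce (2 * n) 2n%3≡1) (reduce n n%3≡2)) refl)
        (cong (λ x → (x + 1) % N a 1) (+-comm (a ^ 1) (a ^ 2)))

proper-divisor⇒¬prime : ∀ {d m} → d ∣ m → 1 < d → d < m → ¬ Prime m
proper-divisor⇒¬prime d∣m 1<d d<m =
  composite⇒¬prime (composite d<m d∣m)
  where instance _ = n>1⇒nonTrivial 1<d

off-three-not-prime : ∀ {a n} → 1 < a → 1 < n → ¬ 3 ∣ n → ¬ Prime (N a n)
off-three-not-prime {a} 1<a 1<n 3∤n = proper-divisor⇒¬prime
  (N1∣N a _ 3∤n)
  (<-trans (s≤s (s≤s z≤n)) (N-mono 1<a (z<s {0})))
  (N-mono 1<a 1<n)

-- Strong induction on n, for all bases at once.
theorem1 : (a n : ℕ) → 1 < a → 1 ≤ n → Prime (a ^ (2 * n) + a ^ n + 1) → ∃[ j ] n ≡ 3 ^ j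
theorem1 a n = <-rec P step n a
  where
    P : ℕ → Set
    P n = ∀ a → 1 < a → 1 ≤ n → Prime (N a n) → ∃[ j ] n ≡ 3 ^ j

    step : ∀ n → (∀ {m} → m < n → P m) → P n
    step n rec a 1<a 1≤n p with 3 ∣? n
    -- n = 3q with q ≥ 1 (q = 0 contradicts 1 ≤ n): descend to q with base a³.
    step _ rec a 1<a _ p | yes (divides (suc q) refl) =
      let j , q≡3ʲ = rec (m<m*n (suc q) 3 (s≤s (s≤s z≤n))) (a ^ 3)
                         (^-monoˡ-< 3 1<a) (s≤s z≤n) (subst Prime (N-scale a 3 (suc q)) p)
      in suc j , trans (*-comm (suc q) 3) (cong (3 *_) q≡3ʲ)
    step (suc zero)    rec a 1<a _ p | no 3∤n = 0 , refl
    step (suc (suc n)) rec a 1<a _ p | no 3∤n =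
      ⊥-elim (off-three-not-prime 1<a (s≤s (s≤s z≤n)) 3∤n p)
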